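{- For all integers $m,n\ge 2$, $\gamma_I(C_m \otimes C_n) \ge \left\lceil \frac{mn}{2}\right\rceil$.
   Context: For an integer $k\ge 2$, $C_k$ denotes the directed cycle with vertex set $\{1,2,\dots,k\}$ and arcs $i\rightarrow i+1$ (indices taken modulo $k$). For digraphs $D_1=(V_1,A_1)$ and $D_2=(V_2,A_2)$, the strong product $D_1\otimes D_2$ is the digraph with vertex set $V_1\times V_2$ in which $(x_1,x_2)\rightarrow(y_1,y_2)$ is an arc if and only if one of the following holds: ($x_1\rightarrow y_1$ in $D_1$ and $x_2\rightarrow y_2$ in $D_2$); ($x_1=y_1$ and $x_2\rightarrow y_2$ in $D_2$); ($x_1\rightarrow y_1$ in $D_1$ and $x_2=y_2$). An Italian dominating function on a digraph $D$ is a function $f:V(D)\to\{0,1,2\}$ such that every vertex $v$ with $f(v)=0$ has at least two in-neighbors $u$ with $f(u)=1$ or at least one in-neighbor $w$ with $f(w)=2$ (an in-neighbor of $v$ is a vertex $u$ with $u\rightarrow v$). Its weight is $\sum_{u\in V(D)} f(u)$, and the Italian domination number $\gamma_I(D)$ is the minimum weight of an Italian dominating function on $D$. -}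

module Defs where

open import Data.Nat using (ℕ; _+_)
import Data.Nat as N
open import Data.Fin using (Fin; toℕ; zero; suc)
open import Data.Empty using (⊥)
open import Data.Product using (_×_; _,_; ∃-syntax)
open import Data.Sum using (_⊎_)
open import Relation.Binary.PropositionalEquality using (_≡_)

Digraph : Set → Set₁
Digraph V = V → V → Set

-- Directed cycle C_k on vertices Fin k (vertex i stands for i+1 of the paper):
-- arc i → j iff j = i + 1 (mod k).
Cyc : (k : ℕ) → Digraph (Fin k)
Cyc k i j = (toℕ j ≡ N.suc (toℕ i)) ⊎ ((N.suc (toℕ i) ≡ k) × (toℕ j ≡ 0))

_⊗_ : {V₁ V₂ : Set} → Digraph V₁ → Digraph V₂ → Digraph (V₁ × V₂)
(D₁ ⊗ D₂) (x₁ , x₂) (y₁ , y₂) =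
    (D₁ x₁ y₁ × D₂ x₂ y₂)
  ⊎ ((x₁ ≡ y₁) × D₂ x₂ y₂)
  ⊎ (D₁ x₁ y₁ × (x₂ ≡ y₂))

IsItalianDF : {V : Set} → Digraph V → (V → Fin 3) → Set
IsItalianDF {V} D f =
  ∀ v → toℕ (f v) ≡ 0 →
      (∃[ u ] ∃[ w ] (D u v × D w v × toℕ (f u) ≡ 1 × toℕ (f w) ≡ 1 × (u ≡ w → ⊥)))
    ⊎ (∃[ u ] (D u v × toℕ (f u) ≡ 2))

sumFin : (k : ℕ) → (Fin k → ℕ) → ℕ
sumFin N.zero    g = 0
sumFin (N.suc k) g = g zero + sumFin k (λ i → g (suc i))

weight : (m n : ℕ) → (Fin m × Fin n → Fin 3) → ℕ
weight m n f = sumFin m (λ i → sumFin n (λ j → toℕ (f (i , j))))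

-- The only in-neighbours of (i+1, j+1) in C_m ⊗ C_n are (i, j), (i, j+1) and
-- (i+1, j). Let every vertex u of label p send p to each of its out-neighbours
-- (i+1, j+1), (i+1, j), (i, j+1) of label 0. A vertex of label 0 then receives
-- at least 2. A vertex of label 1 cannot send 3, for then (i+1, j+1) would have
-- a single in-neighbour of label 1; so a vertex of label p ≠ 0 sends at most
-- 4p − 2. Summing, 2·#{f = 0} ≤ 4w − 2·#{f ≠ 0}, i.e. mn ≤ 2w.
module Submission where

open import Defs
open import Data.Nat using (ℕ; zero; suc; _+_; _*_; _/_; _≤_; z≤n; s≤s; s≤s⁻¹)
open import Data.Nat.DivMod using (m<n*o⇒m/o<n)
open import Data.Nat.Properties
open import Data.Fin using (Fin; zero; suc; toℕ; fromℕ; inject₁)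
open import Data.Fin.Properties using (toℕ-injective; toℕ-fromℕ; toℕ-inject₁)
open import Data.Fin.Relation.Unary.Top using (View; view; ‵fromℕ; ‵inj₁; view-fromℕ; view-inject₁)
open import Algebra.Properties.CommutativeMonoid.Sum +-0-commutativeMonoid
  using (sum; sum-syntax; ∑-distrib-+; sum-cong-≗; sum-init-last)
open import Algebra.Properties.Semiring.Sum +-*-semiring using (*-distribʳ-sum)
open import Data.Product using (_×_; _,_)
open import Data.Sum using (_⊎_; inj₁; inj₂)
open import Data.Empty using (⊥; ⊥-elim)
open import Data.Vec.Functional using (Vector)
open import Function using (_∘_)
open import Relation.Binary.PropositionalEquality

2≤1+1+z : ∀ {x y z} → x ≡ 1 → y ≡ 1 → 2 ≤ x + y + z
2≤1+1+z refl refl = s≤s (s≤s z≤n)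

2≤1+y+1 : ∀ {x y z} → x ≡ 1 → z ≡ 1 → 2 ≤ x + y + z
2≤1+y+1 {y = y} refl refl = s≤s (m≤n+m 1 y)

2≤x+1+1 : ∀ {x y z} → y ≡ 1 → z ≡ 1 → 2 ≤ x + y + z
2≤x+1+1 {x} refl refl = subst (2 ≤_) (sym (+-assoc x 1 1)) (m≤n+m 2 x)

module _ {V : Set} {D : Digraph V} {f : V → Fin 3} (italian : IsItalianDF D f) where

  private
    F : V → ℕ
    F = toℕ ∘ f

  italian-zero⇒2≤in-neighbour-sum : ∀ {v a b c} → (∀ y → D y v → y ≡ a ⊎ y ≡ b ⊎ y ≡ c) →
    toℕ (f v) ≡ 0 → 2 ≤ F a + F b + F c
  italian-zero⇒2≤in-neighbour-sum {v} {a} {b} {c} in⊆ fv≡0 with italian v fv≡0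
  ... | inj₂ (y , y→v , fy≡2) = subst (_≤ F a + F b + F c) fy≡2 (≤-sum (in⊆ y y→v))
    where
    ≤-sum : ∀ {y} → y ≡ a ⊎ y ≡ b ⊎ y ≡ c → F y ≤ F a + F b + F c
    ≤-sum (inj₁ refl)        = ≤-trans (m≤m+n (F a) (F b)) (m≤m+n _ (F c))
    ≤-sum (inj₂ (inj₁ refl)) = ≤-trans (m≤n+m (F b) (F a)) (m≤m+n _ (F c))
    ≤-sum (inj₂ (inj₂ refl)) = m≤n+m (F c) _
  ... | inj₁ (y , w , y→v , w→v , fy≡1 , fw≡1 , y≢w) with in⊆ y y→v | in⊆ w w→v
  ... | inj₁ refl        | inj₁ refl        = ⊥-elim (y≢w refl)
  ... | inj₁ refl        | inj₂ (inj₁ refl) = 2≤1+1+z fy≡1 fw≡1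
  ... | inj₁ refl        | inj₂ (inj₂ refl) = 2≤1+y+1 fy≡1 fw≡1
  ... | inj₂ (inj₁ refl) | inj₁ refl        = 2≤1+1+z fw≡1 fy≡1
  ... | inj₂ (inj₁ refl) | inj₂ (inj₁ refl) = ⊥-elim (y≢w refl)
  ... | inj₂ (inj₁ refl) | inj₂ (inj₂ refl) = 2≤x+1+1 fy≡1 fw≡1
  ... | inj₂ (inj₂ refl) | inj₁ refl        = 2≤1+y+1 fw≡1 fy≡1
  ... | inj₂ (inj₂ refl) | inj₂ (inj₁ refl) = 2≤x+1+1 fw≡1 fy≡1
  ... | inj₂ (inj₂ refl) | inj₂ (inj₂ refl) = ⊥-elim (y≢w refl)

next : ∀ {k} → Fin (suc k) → Fin (suc k)
next i = step (view i)
  where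
  step : ∀ {k} {i : Fin (suc k)} → View i → Fin (suc k)
  step ‵fromℕ           = zero
  step (‵inj₁ {i = j} _) = suc j

next-fromℕ : ∀ k → next (fromℕ k) ≡ zero
next-fromℕ k rewrite view-fromℕ k = refl

next-inject₁ : ∀ {k} (i : Fin k) → next (inject₁ i) ≡ suc i
next-inject₁ i rewrite view-inject₁ i = refl

Cyc-next : ∀ {k} (i : Fin (suc k)) → Cyc (suc k) i (next i)
Cyc-next i with view i
... | ‵fromℕ           = inj₂ (cong suc (toℕ-fromℕ _) , refl)
... | ‵inj₁ {i = j} _ = inj₁ (cong suc (sym (toℕ-inject₁ j)))

Cyc-in-neighbour-unique : ∀ {k} {i i′ j : Fin k} → Cyc k i j → Cyc k i′ j → i ≡ i′
Cyc-in-neighbour-unique (inj₁ j≡1+i) (inj₁ j≡1+i′) = toℕ-injective (suc-injective (trans (sym j≡1+i) j≡1+i′))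
Cyc-in-neighbour-unique (inj₁ j≡1+i) (inj₂ (_ , j≡0)) with () ← trans (sym j≡1+i) j≡0
Cyc-in-neighbour-unique (inj₂ (_ , j≡0)) (inj₁ j≡1+i′) with () ← trans (sym j≡1+i′) j≡0
Cyc-in-neighbour-unique (inj₂ (1+i≡k , _)) (inj₂ (1+i′≡k , _)) = toℕ-injective (suc-injective (trans 1+i≡k (sym 1+i′≡k)))

sum-∘next : ∀ {k} (g : Vector ℕ (suc k)) → sum (g ∘ next) ≡ sum g
sum-∘next {k} g = begin
  sum (g ∘ next)
    ≡⟨ sum-init-last (g ∘ next) ⟩
  sum (g ∘ next ∘ inject₁) + g (next (fromℕ k))
    ≡⟨ cong₂ _+_ (sum-cong-≗ (cong g ∘ next-inject₁)) (cong g (next-fromℕ k)) ⟩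
  sum (g ∘ suc) + g zero
    ≡⟨ +-comm _ (g zero) ⟩
  sum g ∎
  where open ≡-Reasoning

sum-mono-≤ : ∀ {k} {g h : Vector ℕ k} → (∀ i → g i ≤ h i) → sum g ≤ sum h
sum-mono-≤ {zero}  g≤h = z≤n
sum-mono-≤ {suc k} g≤h = +-mono-≤ (g≤h zero) (sum-mono-≤ (g≤h ∘ suc))

sum-const : ∀ k c → sum {k} (λ _ → c) ≡ k * c
sum-const zero    c = refl
sum-const (suc k) c = cong (c +_) (sum-const k c)

∑² : ∀ m n → (Fin m × Fin n → ℕ) → ℕ
∑² m n g = ∑[ i < m ] ∑[ j < n ] g (i , j)

sumFin≡sum : ∀ k (g : Vector ℕ k) → sumFin k g ≡ sum g
sumFin≡sum zero    g = refl
sumFin≡sum (suc k) g = cong (g zero +_) (sumFin≡sum k (g ∘ suc))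

weight≡∑² : ∀ m n (f : Fin m × Fin n → Fin 3) → weight m n f ≡ ∑² m n (toℕ ∘ f)
weight≡∑² m n f = trans (sumFin≡sum m _) (sum-cong-≗ {m} (λ i → sumFin≡sum n _))

module ∑²-Properties (m n : ℕ) where

  ∑²-cong : ∀ {g h : Fin m × Fin n → ℕ} → (∀ u → g u ≡ h u) → ∑² m n g ≡ ∑² m n h
  ∑²-cong g≗h = sum-cong-≗ (λ i → sum-cong-≗ (λ j → g≗h (i , j)))

  ∑²-mono-≤ : ∀ {g h : Fin m × Fin n → ℕ} → (∀ u → g u ≤ h u) → ∑² m n g ≤ ∑² m n h
  ∑²-mono-≤ g≤h = sum-mono-≤ (λ i → sum-mono-≤ (λ j → g≤h (i , j)))

  ∑²-distrib-+ : ∀ (g h : Fin m × Fin n → ℕ) → ∑² m n (λ u → g u + h u) ≡ ∑² m n g + ∑² m n h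
  ∑²-distrib-+ g h = trans (sum-cong-≗ {m} (λ i → ∑-distrib-+ {n} (λ j → g (i , j)) (λ j → h (i , j))))
                           (∑-distrib-+ {m} _ _)

  ∑²-*-distribʳ : ∀ (g : Fin m × Fin n → ℕ) c → ∑² m n g * c ≡ ∑² m n (λ u → g u * c)
  ∑²-*-distribʳ g c = trans (*-distribʳ-sum {m} c _) (sum-cong-≗ (λ i → *-distribʳ-sum {n} c (λ j → g (i , j))))

  ∑²-distrib-+₃ : ∀ (g h k : Fin m × Fin n → ℕ) →
    ∑² m n (λ u → g u + h u + k u) ≡ ∑² m n g + ∑² m n h + ∑² m n k
  ∑²-distrib-+₃ g h k = trans (∑²-distrib-+ (λ u → g u + h u) k) (cong (_+ ∑² m n k) (∑²-distrib-+ g h))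

  ∑²-const : ∀ c → ∑² m n (λ _ → c) ≡ m * (n * c)
  ∑²-const c = trans (sum-cong-≗ {m} (λ _ → sum-const n c)) (sum-const m (n * c))

whenZero : Fin 3 → ℕ → ℕ
whenZero zero    k = k
whenZero (suc _) k = 0

whenNonzero : Fin 3 → ℕ → ℕ
whenNonzero zero    k = 0
whenNonzero (suc _) k = k

whenZero+whenNonzero : ∀ x k → whenZero x k + whenNonzero x k ≡ k
whenZero+whenNonzero zero    k = +-identityʳ k
whenZero+whenNonzero (suc _) k = refl

whenZero-≤ : ∀ x k → whenZero x k ≤ k
whenZero-≤ zero    k = ≤-refl
whenZero-≤ (suc _) k = z≤n

whenZero³-≤ : ∀ x y z k → whenZero x k + whenZero y k + whenZero z k ≤ k + k + k
whenZero³-≤ x y z k = +-mono-≤ (+-mono-≤ (whenZero-≤ x k) (whenZero-≤ y k)) (whenZero-≤ z k)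

whenZero-received : ∀ x a b c → (toℕ x ≡ 0 → 2 ≤ a + b + c) →
  whenZero x 2 ≤ whenZero x a + whenZero x b + whenZero x c
whenZero-received zero    a b c 2≤a+b+c = 2≤a+b+c refl
whenZero-received (suc _) a b c _       = z≤n

whenZero-sent : ∀ p x y z → (toℕ p ≡ 1 → toℕ x ≡ 0 → toℕ y ≡ 0 → toℕ z ≡ 0 → ⊥) →
  whenZero x (toℕ p) + whenZero y (toℕ p) + whenZero z (toℕ p) + whenNonzero p 2 ≤ toℕ p * 4
whenZero-sent zero             x       y       z       _ = +-monoˡ-≤ 0 (whenZero³-≤ x y z 0)
whenZero-sent (suc (suc zero)) x       y       z       _ = +-monoˡ-≤ 2 (whenZero³-≤ x y z 2)
whenZero-sent (suc zero)       (suc _) y       z       _ = +-monoˡ-≤ 2 (+-mono-≤ (whenZero-≤ y 1) (whenZero-≤ z 1))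
whenZero-sent (suc zero)       zero    (suc _) z       _ = s≤s (+-monoˡ-≤ 2 (whenZero-≤ z 1))
whenZero-sent (suc zero)       zero    zero    (suc _) _ = ≤-refl
whenZero-sent (suc zero)       zero    zero    zero    isolated = ⊥-elim (isolated refl refl refl refl)

module Torus (m n : ℕ) where

  Vertex : Set
  Vertex = Fin (suc m) × Fin (suc n)

  right down diag : Vertex → Vertex
  right (i , j) = (i , next j)
  down  (i , j) = (next i , j)
  diag  (i , j) = (next i , next j)

  in-neighbour-of-diag : ∀ u y → (Cyc (suc m) ⊗ Cyc (suc n)) y (diag u) →
    y ≡ u ⊎ y ≡ right u ⊎ y ≡ down u
  in-neighbour-of-diag (i , j) (y₁ , y₂) (inj₁ (y₁→ , y₂→)) =
    inj₁ (cong₂ _,_ (Cyc-in-neighbour-unique y₁→ (Cyc-next i)) (Cyc-in-neighbour-unique y₂→ (Cyc-next j)))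
  in-neighbour-of-diag (i , j) (y₁ , y₂) (inj₂ (inj₁ (refl , y₂→))) =
    inj₂ (inj₂ (cong (next i ,_) (Cyc-in-neighbour-unique y₂→ (Cyc-next j))))
  in-neighbour-of-diag (i , j) (y₁ , y₂) (inj₂ (inj₂ (y₁→ , refl))) =
    inj₂ (inj₁ (cong (_, next j) (Cyc-in-neighbour-unique y₁→ (Cyc-next i))))

  ∑²-∘right : ∀ (g : Vertex → ℕ) → ∑² (suc m) (suc n) (g ∘ right) ≡ ∑² (suc m) (suc n) g
  ∑²-∘right g = sum-cong-≗ (λ i → sum-∘next (λ j → g (i , j)))

  ∑²-∘down : ∀ (g : Vertex → ℕ) → ∑² (suc m) (suc n) (g ∘ down) ≡ ∑² (suc m) (suc n) g
  ∑²-∘down g = sum-∘next (λ i → ∑[ j < suc n ] g (i , j))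

  ∑²-∘diag : ∀ (g : Vertex → ℕ) → ∑² (suc m) (suc n) (g ∘ diag) ≡ ∑² (suc m) (suc n) g
  ∑²-∘diag g = trans (∑²-∘right (g ∘ down)) (∑²-∘down g)

  open ∑²-Properties (suc m) (suc n)

  module _ {f : Vertex → Fin 3} (italian : IsItalianDF (Cyc (suc m) ⊗ Cyc (suc n)) f) where

    private
      F : Vertex → ℕ
      F = toℕ ∘ f

      Σ : (Vertex → ℕ) → ℕ
      Σ = ∑² (suc m) (suc n)

    need spare : Vertex → ℕ
    need u  = whenZero (f u) 2
    spare u = whenNonzero (f u) 2

    charge : (Vertex → Vertex) → Vertex → ℕ
    charge out u = whenZero (f (out u)) (F u)

    -- received u is what diag u collects from its three in-neighbours u, right u, down u.
    sent received : Vertex → ℕ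
    sent u     = charge diag u + charge down u + charge right u
    received u = charge diag u + charge down (right u) + charge right (down u)

    need≤received : ∀ u → need (diag u) ≤ received u
    need≤received u = whenZero-received (f (diag u)) (F u) (F (right u)) (F (down u))
      (italian-zero⇒2≤in-neighbour-sum italian (in-neighbour-of-diag u))

    sent+spare≤4F : ∀ u → sent u + spare u ≤ F u * 4
    sent+spare≤4F u = whenZero-sent (f u) (f (diag u)) (f (down u)) (f (right u)) isolated
      where
      isolated : F u ≡ 1 → F (diag u) ≡ 0 → F (down u) ≡ 0 → F (right u) ≡ 0 → ⊥
      isolated fu≡1 fdiag≡0 fdown≡0 fright≡0 = <-irrefl refl (subst (2 ≤_) in-sum≡1 2≤in-sum)
        where
        2≤in-sum : 2 ≤ F u + F (right u) + F (down u)
        2≤in-sum = italian-zero⇒2≤in-neighbour-sum italian (in-neighbour-of-diag u) fdiag≡0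
        in-sum≡1 : F u + F (right u) + F (down u) ≡ 1
        in-sum≡1 = cong₂ _+_ (cong₂ _+_ fu≡1 fright≡0) fdown≡0

    Σreceived≡Σsent : Σ received ≡ Σ sent
    Σreceived≡Σsent = begin
      Σ received
        ≡⟨ ∑²-distrib-+₃ (charge diag) (charge down ∘ right) (charge right ∘ down) ⟩
      Σ (charge diag) + Σ (charge down ∘ right) + Σ (charge right ∘ down)
        ≡⟨ cong₂ (λ a b → Σ (charge diag) + a + b) (∑²-∘right (charge down)) (∑²-∘down (charge right)) ⟩
      Σ (charge diag) + Σ (charge down) + Σ (charge right)
        ≡⟨ ∑²-distrib-+₃ (charge diag) (charge down) (charge right) ⟨
      Σ sent ∎
      where open ≡-Reasoning

    weight-bound : suc m * suc n ≤ weight (suc m) (suc n) f * 2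
    weight-bound = *-cancelʳ-≤ _ _ 2 (begin
      suc m * suc n * 2               ≡⟨ *-assoc (suc m) (suc n) 2 ⟩
      suc m * (suc n * 2)             ≡⟨ ∑²-const 2 ⟨
      Σ (λ _ → 2)                     ≡⟨ ∑²-cong (λ u → whenZero+whenNonzero (f u) 2) ⟨
      Σ (λ u → need u + spare u)      ≡⟨ ∑²-distrib-+ need spare ⟩
      Σ need + Σ spare                ≡⟨ cong (_+ Σ spare) (∑²-∘diag need) ⟨
      Σ (need ∘ diag) + Σ spare       ≤⟨ +-monoˡ-≤ (Σ spare) (∑²-mono-≤ need≤received) ⟩
      Σ received + Σ spare            ≡⟨ cong (_+ Σ spare) Σreceived≡Σsent ⟩
      Σ sent + Σ spare                ≡⟨ ∑²-distrib-+ sent spare ⟨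
      Σ (λ u → sent u + spare u)      ≤⟨ ∑²-mono-≤ sent+spare≤4F ⟩
      Σ (λ u → F u * 4)               ≡⟨ ∑²-*-distribʳ F 4 ⟨
      Σ F * 4                         ≡⟨ *-assoc (Σ F) 2 2 ⟨
      Σ F * 2 * 2                     ≡⟨ cong (λ w → w * 2 * 2) (weight≡∑² (suc m) (suc n) f) ⟨
      weight (suc m) (suc n) f * 2 * 2 ∎)
      where open ≤-Reasoning

m≤n*2⇒[1+m]/2≤n : ∀ {m n} → m ≤ n * 2 → suc m / 2 ≤ n
m≤n*2⇒[1+m]/2≤n {m} {n} m≤n*2 = s≤s⁻¹ (m<n*o⇒m/o<n {suc m} {suc n} {2} (s≤s (s≤s m≤n*2)))

-- The counting needs only m, n ≥ 1.
lemma2p4 : (m n : ℕ) → 2 ≤ m → 2 ≤ n →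
    (f : Fin m × Fin n → Fin 3) → IsItalianDF (Cyc m ⊗ Cyc n) f →
    (suc (m * n)) / 2 ≤ weight m n f
lemma2p4 (suc m) (suc n) _ _ f italian = m≤n*2⇒[1+m]/2≤n (Torus.weight-bound m n italian)
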